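{- For every integer $q\geq 5$ and every rational number $r$ with $r>\tfrac12$, there exists $v\in\mathbb{N}$ such that $\frac{s_q(v^2)}{s_q(v)}=r$.
   Context: $s_q(n)$ denotes the sum of the digits of $n$ in base $q$. -}

module Defs where

open import Data.Nat using (ℕ; zero; suc; _+_; _*_; _≤_; NonZero)
open import Data.Nat.DivMod using (_/_; _%_)

digitSumFuel : ℕ → (q : ℕ) → .{{NonZero q}} → ℕ → ℕ
digitSumFuel zero    q n = 0
digitSumFuel (suc f) q n = n % q + digitSumFuel f q (n / q)

-- s_q(n): sum of the base-q digits of n (for q ≥ 2, n has at most n digits,
-- so fuel n suffices)
s : (q : ℕ) → .{{NonZero q}} → ℕ → ℕ
s q n = digitSumFuel n q n

module Submission where

-- Write Q = q - 1 for the largest digit.  (1) Digit sums are additive over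
-- blocks: if x < q^e then s(x + q^e·y) = s(x) + s(y) (s-concat, s-blocks).
-- (2) Amplification: n copies of w placed at very sparse positions give
-- v = w·M n with s(v) = n·s(w) and s(v²) = n·s(w²) + Tr(n)·s(2w²), because
-- (w·M n)² consists of non-overlapping blocks w² and 2w² (Spread, amplify).
-- (3) For q ≥ 5 and K < p' an explicit gadget w, built from X = q^{K+1}
-- and P = q^{p'+1}, has s(w) = (2(p'+1) + (K+1))·Q and
-- s(w²) = s(2w²) = ((p'+1) + 3(K+1))·Q (Gadget).  (4) For r = a/b with
-- b < 2a, take n = ⌊2a/b⌋ and K, p' making these factors 5(n+1)b and 10a;
-- then s(v) = T·b and s(v²) = T·a with T = 5n(n+1)·Q (realise).
-- (5) Hence s(v²)/s(v) = a/b = r (ratio-realised, lemma3p7).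

module Construction where
  open import Defs using (digitSumFuel; s)
  open import Data.Nat
  open import Data.Nat.Properties
  open import Data.Nat.DivMod
  open import Data.Nat.Divisibility using (m∣m*n)
  open import Data.Nat.Tactic.RingSolver using (solve-∀)
  open import Data.List using (List; []; _∷_; map)
  open import Data.Nat.ListAction using (sum)
  open import Data.List.Relation.Unary.All using (All; []; _∷_)
  open import Data.Product using (∃; _×_; _,_)
  open import Relation.Binary.PropositionalEquality

  fromBlocks : ℕ → List ℕ → ℕ
  fromBlocks B []       = 0
  fromBlocks B (b ∷ bs) = b + B * fromBlocks B bs

  block< : ∀ {B d t m} → d < B → t < m → d + B * t < B * m
  block< {B} {d} {t} {m} d<B t<m = begin-strict
    d + B * t  <⟨ +-monoˡ-< (B * t) d<B ⟩
    B + B * t  ≡⟨ *-suc B t ⟨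
    B * suc t  ≤⟨ *-monoʳ-≤ B t<m ⟩
    B * m      ∎
    where open ≤-Reasoning

  -- Splitting off the last digit r of x = r + t·q below an appended block q·z·y.
  regroup-digits : ∀ r t q z y → r + t * q + q * z * y ≡ r + q * (t + z * y)
  regroup-digits = solve-∀

  module Base (q : ℕ) .{{_ : NonZero q}} (1<q : 1 < q) where

    -- Dividing by q shortens a number, so fuel f suffices for n / q when n ≤ 1 + f.
    quotient-fits : ∀ {n f} → n ≤ suc f → n / q ≤ f
    quotient-fits {zero}  {f} _   = subst (_≤ f) (sym (0/n≡0 q)) z≤n
    quotient-fits {suc n}     n≤f = s≤s⁻¹ (<-≤-trans (m/n<m (suc n) q 1<q) n≤f)

    digitSumFuel-zero : ∀ f → digitSumFuel f q 0 ≡ 0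
    digitSumFuel-zero zero    = refl
    digitSumFuel-zero (suc f) =
      cong₂ _+_ (m<n⇒m%n≡m (<-trans z<s 1<q))
                (trans (cong (digitSumFuel f q) (0/n≡0 q)) (digitSumFuel-zero f))

    fuel-irrelevant : ∀ {f g n} → n ≤ f → n ≤ g → digitSumFuel f q n ≡ digitSumFuel g q n
    fuel-irrelevant {zero}  {zero}  _   _   = refl
    fuel-irrelevant {zero}  {suc g} z≤n _   = sym (digitSumFuel-zero (suc g))
    fuel-irrelevant {suc f} {zero}  _   z≤n = digitSumFuel-zero (suc f)
    fuel-irrelevant {suc f} {suc g} {n} n≤f n≤g =
      cong (n % q +_) (fuel-irrelevant (quotient-fits n≤f) (quotient-fits n≤g))

    s-digits : ∀ n → s q n ≡ n % q + s q (n / q)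
    s-digits n = trans (fuel-irrelevant {n} {suc n} ≤-refl (n≤1+n n))
                       (cong (n % q +_) (fuel-irrelevant (quotient-fits (n≤1+n n)) ≤-refl))

    s-step : ∀ {r} t → r < q → s q (r + q * t) ≡ r + s q t
    s-step {r} t r<q = begin
      s q (r + q * t)                          ≡⟨ s-digits (r + q * t) ⟩
      (r + q * t) % q + s q ((r + q * t) / q)  ≡⟨ cong₂ (λ d n → d + s q n) last-digit rest ⟩
      r + s q t                                ∎
      where
      open ≡-Reasoning
      last-digit : (r + q * t) % q ≡ r
      last-digit = trans (%-congˡ (cong (r +_) (*-comm q t)))
                         (trans ([m+kn]%n≡m%n r t q) (m<n⇒m%n≡m r<q))
      rest : (r + q * t) / q ≡ t
      rest = trans (+-distrib-/-∣ʳ r (m∣m*n t))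
                   (cong₂ _+_ (m<n⇒m/n≡0 r<q) (trans (/-congˡ (*-comm q t)) (m*n/n≡m t q)))

    BlockBase : ℕ → Set
    BlockBase B = ∀ {x} y → x < B → s q (x + B * y) ≡ s q x + s q y

    s-concat : ∀ e → BlockBase (q ^ e)
    s-concat zero {zero} y _ = cong (s q) (+-identityʳ y)
    s-concat zero {suc x} y (s≤s ())
    s-concat (suc e) {x} y x<q^1+e = begin
      s q (x + q ^ suc e * y)                ≡⟨ cong (s q) regroup ⟩
      s q (x % q + q * (x / q + q ^ e * y))  ≡⟨ s-step _ (m%n<n x q) ⟩
      x % q + s q (x / q + q ^ e * y)        ≡⟨ cong (x % q +_) (s-concat e y quotient<) ⟩
      x % q + (s q (x / q) + s q y)          ≡⟨ +-assoc (x % q) _ _ ⟨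
      x % q + s q (x / q) + s q y            ≡⟨ cong (_+ s q y) (s-digits x) ⟨
      s q x + s q y                          ∎
      where
      open ≡-Reasoning
      quotient< : x / q < q ^ e
      quotient< = m<n*o⇒m/o<n (subst (x <_) (*-comm q (q ^ e)) x<q^1+e)
      regroup : x + q ^ suc e * y ≡ x % q + q * (x / q + q ^ e * y)
      regroup = trans (cong (_+ q ^ suc e * y) (m≡m%n+[m/n]*n x q))
                      (regroup-digits (x % q) (x / q) q (q ^ e) y)

    s-digit : ∀ {d} → d < q → s q d ≡ d
    s-digit {d} d<q = begin
      s q d            ≡⟨ cong (s q) (trans (cong (d +_) (*-zeroʳ q)) (+-identityʳ d)) ⟨
      s q (d + q * 0)  ≡⟨ s-step 0 d<q ⟩
      d + 0            ≡⟨ +-identityʳ d ⟩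
      d                ∎
      where open ≡-Reasoning

    s-blocks : ∀ {B} → BlockBase B → ∀ {bs} → All (_< B) bs →
               s q (fromBlocks B bs) ≡ sum (map (s q) bs)
    s-blocks split []                    = refl
    s-blocks split {b ∷ _} (b<B ∷ bs<B) = trans (split _ b<B) (cong (s q b +_) (s-blocks split bs<B))

    n<q^n : ∀ n → n < q ^ n
    n<q^n zero    = z<s
    n<q^n (suc n) = begin-strict
      suc n      ≤⟨ n<q^n n ⟩
      q ^ n      <⟨ m<m*n (q ^ n) q {{m^n≢0 q n}} 1<q ⟩
      q ^ n * q  ≡⟨ *-comm (q ^ n) q ⟩
      q * q ^ n  ∎
      where open ≤-Reasoning

  -- Triangular numbers: Tr n = n(n-1)/2 counts the pairs i < j < n.
  Tr : ℕ → ℕ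
  Tr zero    = 0
  Tr (suc n) = Tr n + n

  triangular : ∀ n → 2 * Tr (suc n) ≡ n * suc n
  triangular zero    = refl
  triangular (suc n) = begin
    2 * (Tr (suc n) + suc n)        ≡⟨ *-distribˡ-+ 2 (Tr (suc n)) (suc n) ⟩
    2 * Tr (suc n) + 2 * suc n      ≡⟨ cong (_+ 2 * suc n) (triangular n) ⟩
    n * suc n + 2 * suc n           ≡⟨ *-distribʳ-+ (suc n) n 2 ⟨
    (n + 2) * suc n                 ≡⟨ *-comm (n + 2) (suc n) ⟩
    suc n * (n + 2)                 ≡⟨ cong (suc n *_) (+-comm n 2) ⟩
    suc n * suc (suc n)             ∎
    where open ≡-Reasoning

  square-split : ∀ w m r → (w * (m + r)) * (w * (m + r)) ≡
                 (w * m) * (w * m) + r * ((2 * (w * w)) * m + r * (w * w))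
  square-split = solve-∀

  square-product : ∀ w m → (w * m) * (w * m) ≡ (w * w) * (m * m)
  square-product = solve-∀

  -- With
  -- top 0 = 0, pos n = G + 2·top n and top (n+1) = pos n + 1, the number
  -- M n = Σ_{i<n} q^{pos i} is such that for t < q^G the copies of t in t·M n
  -- do not overlap, and for w² < q^G the n² products in (w·M n)² collapse into
  -- n separated blocks w² and Tr n separated blocks 2w².
  module Spread (q : ℕ) .{{_ : NonZero q}} (1<q : 1 < q) (G : ℕ) where
    open Base q 1<q

    top pos : ℕ → ℕ
    top zero    = 0
    top (suc n) = suc (pos n)
    pos n = G + (top n + top n)

    M : ℕ → ℕ
    M zero    = 0
    M (suc n) = M n + q ^ pos n

    M<q^top : ∀ n → M n < q ^ top n
    M<q^top zero    = z<s
    M<q^top (suc n) = begin-strict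
      M n + q ^ pos n      <⟨ +-monoˡ-< (q ^ pos n) (<-≤-trans (M<q^top n) (^-monoʳ-≤ q top≤pos)) ⟩
      q ^ pos n + q ^ pos n ≡⟨ cong (q ^ pos n +_) (+-identityʳ (q ^ pos n)) ⟨
      2 * q ^ pos n        ≤⟨ *-monoˡ-≤ (q ^ pos n) 1<q ⟩
      q ^ suc (pos n)      ∎
      where
      open ≤-Reasoning
      top≤pos : top n ≤ pos n
      top≤pos = ≤-trans (m≤m+n (top n) (top n)) (m≤n+m (top n + top n) G)

    spread< : ∀ {t} n → t < q ^ G → t * M n < q ^ pos n
    spread< {t} n t<q^G = begin-strict
      t * M n             <⟨ *-mono-< t<q^G (M<q^top n) ⟩
      q ^ G * q ^ top n   ≡⟨ ^-distribˡ-+-* q G (top n) ⟨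
      q ^ (G + top n)     ≤⟨ ^-monoʳ-≤ q (+-monoʳ-≤ G (m≤m+n (top n) (top n))) ⟩
      q ^ pos n           ∎
      where open ≤-Reasoning

    spread-square< : ∀ {w} n → w * w < q ^ G → (w * M n) * (w * M n) < q ^ pos n
    spread-square< {w} n w²<q^G = begin-strict
      (w * M n) * (w * M n)          ≡⟨ square-product w (M n) ⟩
      (w * w) * (M n * M n)          <⟨ *-mono-< w²<q^G (*-mono-< (M<q^top n) (M<q^top n)) ⟩
      q ^ G * (q ^ top n * q ^ top n) ≡⟨ cong (q ^ G *_) (^-distribˡ-+-* q (top n) (top n)) ⟨
      q ^ G * q ^ (top n + top n)    ≡⟨ ^-distribˡ-+-* q G (top n + top n) ⟨
      q ^ pos n                      ∎
      where open ≤-Reasoning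

    s-spread : ∀ {t} n → t < q ^ G → s q (t * M n) ≡ n * s q t
    s-spread {t} zero    _     = cong (s q) (*-zeroʳ t)
    s-spread {t} (suc n) t<q^G = begin
      s q (t * (M n + q ^ pos n))   ≡⟨ cong (s q) (trans (*-distribˡ-+ t (M n) _) (cong (t * M n +_) (*-comm t _))) ⟩
      s q (t * M n + q ^ pos n * t) ≡⟨ s-concat (pos n) t (spread< n t<q^G) ⟩
      s q (t * M n) + s q t         ≡⟨ cong (_+ s q t) (s-spread n t<q^G) ⟩
      n * s q t + s q t             ≡⟨ +-comm (n * s q t) (s q t) ⟩
      suc n * s q t                 ∎
      where open ≡-Reasoning

    s-spread-square : ∀ {w} n → w * w < q ^ G → 2 * (w * w) < q ^ G →
                      s q ((w * M n) * (w * M n)) ≡ n * s q (w * w) + Tr n * s q (2 * (w * w))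
    s-spread-square {w} zero    _     _      = cong (s q) (trans (square-product w 0) (*-zeroʳ (w * w)))
    s-spread-square {w} (suc n) w²<q^G 2w²<q^G = begin
      s q ((w * (M n + r)) * (w * (M n + r)))
        ≡⟨ cong (s q) (square-split w (M n) r) ⟩
      s q ((w * M n) * (w * M n) + r * (2w² * M n + r * w²))
        ≡⟨ s-concat (pos n) _ (spread-square< {w} n w²<q^G) ⟩
      s q ((w * M n) * (w * M n)) + s q (2w² * M n + r * w²)
        ≡⟨ cong₂ _+_ (s-spread-square {w} n w²<q^G 2w²<q^G) (s-concat (pos n) w² (spread< n 2w²<q^G)) ⟩
      n * s q w² + Tr n * s q 2w² + (s q (2w² * M n) + s q w²)
        ≡⟨ cong (λ x → n * s q w² + Tr n * s q 2w² + (x + s q w²)) (s-spread n 2w²<q^G) ⟩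
      n * s q w² + Tr n * s q 2w² + (n * s q 2w² + s q w²)
        ≡⟨ collect n (s q w²) (s q 2w²) (Tr n) ⟩
      suc n * s q w² + (Tr n + n) * s q 2w² ∎
      where
      open ≡-Reasoning
      r w² 2w² : ℕ
      r = q ^ pos n
      w² = w * w
      2w² = 2 * (w * w)
      collect : ∀ n a b t → n * a + t * b + (n * b + a) ≡ suc n * a + (t + n) * b
      collect = solve-∀

  -- Amplification: for any w there is v with s(v) = n·s(w), and
  -- s(v²) = Tr(n+1)·β as soon as s(w²) = s(2w²) = β.  Take v = w·M n with
  -- spacing G = 2w² + w, which exceeds both w² and 2w².
  amplify : ∀ q .{{_ : NonZero q}} → 1 < q → ∀ w n {β} →
            s q (w * w) ≡ β → s q (2 * (w * w)) ≡ β →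
            ∃ λ v → s q v ≡ n * s q w × s q (v * v) ≡ Tr (suc n) * β
  amplify q 1<q w n {β} s-w²≡β s-2w²≡β = w * M n , s-spread {w} n w<q^G , (begin
    s q ((w * M n) * (w * M n))                 ≡⟨ s-spread-square {w} n w²<q^G 2w²<q^G ⟩
    n * s q (w * w) + Tr n * s q (2 * (w * w))  ≡⟨ cong₂ (λ x y → n * x + Tr n * y) s-w²≡β s-2w²≡β ⟩
    n * β + Tr n * β                            ≡⟨ *-distribʳ-+ β n (Tr n) ⟨
    (n + Tr n) * β                              ≡⟨ cong (_* β) (+-comm n (Tr n)) ⟩
    Tr (suc n) * β                              ∎)
    where
    open ≡-Reasoning
    open Base q 1<q using (n<q^n)
    G : ℕ
    G = 2 * (w * w) + w
    open Spread q 1<q G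
    G<q^G : G < q ^ G
    G<q^G = n<q^n G
    w<q^G : w < q ^ G
    w<q^G = ≤-<-trans (m≤n+m w (2 * (w * w))) G<q^G
    2w²<q^G : 2 * (w * w) < q ^ G
    2w²<q^G = ≤-<-trans (m≤m+n (2 * (w * w)) w) G<q^G
    w²<q^G : w * w < q ^ G
    w²<q^G = ≤-<-trans (m≤m+n (w * w) (w * w + 0)) 2w²<q^G

  -- The polynomial identities behind the gadget below: with X = 5 + c + u,
  -- P = 5 + c + y and Z = XP (later X = q^{K+1}, P = q^{p'+1}), the square
  -- w² and the double square 2w² of the gadget w are written in base Z with
  -- blocks that are themselves two-block numbers in base X.
  square-identity : ∀ c u y →
      let X = 5 + c + u ; P = 5 + c + y ; Z = X * P
          w = 1 + X * (4 + c + y) + Z * (4 + c + u + X * (3 + c + y) + Z * 0)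
      in w * w ≡ 1 + X * (3 + c + u) + Z * (X * (3 + c + u + X * 1)
                   + Z * (2 + X * (3 + c + u) + Z * (X * (3 + c + y) + Z * 0)))
  square-identity = solve-∀

  double-square-identity : ∀ c u y →
      let X = 5 + c + u ; P = 5 + c + y ; Z = X * P
          w = 1 + X * (4 + c + y) + Z * (4 + c + u + X * (3 + c + y) + Z * 0)
      in 2 * (w * w) ≡ 2 + X * (1 + c + u + X * 1) + Z * (X * (1 + c + u + X * 3)
                   + Z * (4 + X * (1 + c + u + X * 1) + Z * (X * (1 + c + y) + Z * (1 + Z * 0))))
  double-square-identity = solve-∀

  module AtLeastFive (c : ℕ) where
    q Q : ℕ
    q = 5 + c
    Q = 4 + c

    1<q : 1 < q
    1<q = s≤s (s≤s z≤n)

    open Base q 1<q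

    small< : ∀ {d} → d ≤ 4 → d < q
    small< d≤4 = s≤s (≤-trans d≤4 (m≤m+n 4 c))

    shifted< : ∀ {e} → e ≤ 4 → e + c < q
    shifted< e≤4 = s≤s (+-monoˡ-≤ c e≤4)

    full : ℕ → ℕ
    full zero    = 0
    full (suc m) = Q + q * full m

    pow-full : ∀ m → q ^ m ≡ suc (full m)
    pow-full zero    = refl
    pow-full (suc m) = trans (cong (q *_) (pow-full m)) (*-suc q (full m))

    s-full : ∀ m → s q (full m) ≡ m * Q
    s-full zero    = refl
    s-full (suc m) = trans (s-step (full m) (n<1+n Q)) (cong (Q +_) (s-full m))

    s-below-full : ∀ {e} m → e < q → s q (e + q * full m) ≡ e + m * Q
    s-below-full {e} m e<q = trans (s-step (full m) e<q) (cong (e +_) (s-full m))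

    module Gadget (K p' : ℕ) (K<p' : K < p') where
      u y X P Z : ℕ
      u = q * full K
      y = q * full p'
      X = q + u
      P = q + y
      Z = X * P

      X≡ : q ^ suc K ≡ X
      X≡ = pow-full (suc K)

      P≡ : q ^ suc p' ≡ P
      P≡ = pow-full (suc p')

      X-base : BlockBase X
      X-base = subst BlockBase X≡ (s-concat (suc K))

      Z-base : BlockBase Z
      Z-base = subst BlockBase (trans (^-distribˡ-+-* q (suc K) (suc p')) (cong₂ _*_ X≡ P≡))
                     (s-concat (suc K + suc p'))

      -- K < p' leaves room above X: the base-X blocks d + X·j (j ≤ 4) stay below P.
      X*5≤P : X * 5 ≤ P
      X*5≤P = begin
        X * 5          ≤⟨ *-monoʳ-≤ X (m≤m+n 5 c) ⟩
        X * q          ≡⟨ cong (_* q) X≡ ⟨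
        q ^ suc K * q  ≡⟨ *-comm (q ^ suc K) q ⟩
        q ^ suc (suc K) ≤⟨ ^-monoʳ-≤ q (s≤s K<p') ⟩
        q ^ suc p'     ≡⟨ P≡ ⟩
        P              ∎
        where open ≤-Reasoning

      digit< : ∀ {d} → d ≤ 4 → d < X
      digit< d≤4 = ≤-trans (small< d≤4) (m≤m+n q u)

      low< : ∀ {e} → e < q → e + u < X
      low< = +-monoˡ-< u

      high< : ∀ {e} → e < q → e + y < P
      high< = +-monoˡ-< y

      s-low : ∀ {e} → e < q → s q (e + u) ≡ e + K * Q
      s-low = s-below-full K

      s-high : ∀ {e} → e < q → s q (e + y) ≡ e + p' * Q
      s-high = s-below-full p'

      X≤P : X ≤ P
      X≤P = ≤-trans (m≤m*n X 5) X*5≤P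

      inner< : ∀ {d j} → d < X → j ≤ 4 → d + X * j < P
      inner< d<X j≤4 = ≤-trans (block< d<X (s≤s j≤4)) X*5≤P

      1≤4 : 1 ≤ 4
      1≤4 = s≤s z≤n
      2≤4 : 2 ≤ 4
      2≤4 = s≤s (s≤s z≤n)
      3≤4 : 3 ≤ 4
      3≤4 = s≤s (s≤s (s≤s z≤n))

      s-block : ∀ {d} t → d ≤ 4 → s q (d + X * t) ≡ d + s q t
      s-block t d≤4 = trans (X-base t (digit< d≤4)) (cong (_+ s q t) (s-digit (small< d≤4)))

      s-nested : ∀ {d a j} → d ≤ 4 → a < X → j ≤ 4 → s q (d + X * (a + X * j)) ≡ d + (s q a + j)
      s-nested {d} {a} {j} d≤4 a<X j≤4 =
        trans (s-block (a + X * j) d≤4)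
              (cong (d +_) (trans (X-base j a<X) (cong (s q a +_) (s-digit (small< j≤4)))))

      -- The gadget w = 1 + X(P-1) + Z(X-1 + X(P-2)), and the base-Z blocks of w² and 2w².
      wBlocks squareBlocks doubleSquareBlocks : List ℕ
      wBlocks = 1 + X * (4 + c + y) ∷ 4 + c + u + X * (3 + c + y) ∷ []
      squareBlocks = 1 + X * (3 + c + u) ∷ X * (3 + c + u + X * 1) ∷ 2 + X * (3 + c + u)
                   ∷ X * (3 + c + y) ∷ []
      doubleSquareBlocks = 2 + X * (1 + c + u + X * 1) ∷ X * (1 + c + u + X * 3)
                         ∷ 4 + X * (1 + c + u + X * 1) ∷ X * (1 + c + y) ∷ 1 ∷ []

      w : ℕ
      w = fromBlocks Z wBlocks

      w-squared : w * w ≡ fromBlocks Z squareBlocks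
      w-squared = square-identity c u y

      w-double-squared : 2 * (w * w) ≡ fromBlocks Z doubleSquareBlocks
      w-double-squared = double-square-identity c u y

      s-w : s q w ≡ (2 * suc p' + suc K) * Q
      s-w = begin
        s q w                      ≡⟨ s-blocks Z-base bounds ⟩
        sum (map (s q) wBlocks)
          ≡⟨ cong₂ (λ α β → α + (β + 0)) (s-block (4 + c + y) 1≤4) (X-base (3 + c + y) (low< (shifted< ≤-refl))) ⟩
        (1 + s q (4 + c + y)) + ((s q (4 + c + u) + s q (3 + c + y)) + 0)
          ≡⟨ cong₂ (λ α β → (1 + α) + (β + 0)) (s-high (shifted< ≤-refl))
                   (cong₂ _+_ (s-low (shifted< ≤-refl)) (s-high (shifted< 3≤4))) ⟩
        (1 + (4 + c + p' * Q)) + ((4 + c + K * Q + (3 + c + p' * Q)) + 0)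
          ≡⟨ collect c K p' ⟩
        (2 * suc p' + suc K) * Q   ∎
        where
        open ≡-Reasoning
        bounds : All (_< Z) wBlocks
        bounds = block< (digit< 1≤4) (high< (shifted< ≤-refl))
               ∷ block< (low< (shifted< ≤-refl)) (high< (shifted< 3≤4)) ∷ []
        collect : ∀ c K p' → (1 + (4 + c + p' * (4 + c))) + ((4 + c + K * (4 + c) + (3 + c + p' * (4 + c))) + 0)
                             ≡ (2 * suc p' + suc K) * (4 + c)
        collect = solve-∀

      s-w² : s q (w * w) ≡ (suc p' + 3 * suc K) * Q
      s-w² = begin
        s q (w * w)                      ≡⟨ cong (s q) w-squared ⟩
        s q (fromBlocks Z squareBlocks)  ≡⟨ s-blocks Z-base bounds ⟩
        sum (map (s q) squareBlocks)
          ≡⟨ cong₂ _+_ (s-block a 1≤4) (cong₂ _+_ (s-nested z≤n a<X 1≤4)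
               (cong₂ _+_ (s-block a 2≤4) (cong (_+ 0) (s-block (3 + c + y) z≤n)))) ⟩
        (1 + s q a) + ((s q a + 1) + ((2 + s q a) + (s q (3 + c + y) + 0)))
          ≡⟨ cong₂ (λ α β → (1 + α) + ((α + 1) + ((2 + α) + (β + 0))))
                   (s-low (shifted< 3≤4)) (s-high (shifted< 3≤4)) ⟩
        (1 + σ) + ((σ + 1) + ((2 + σ) + ((3 + c + p' * Q) + 0)))
          ≡⟨ collect c K p' ⟩
        (suc p' + 3 * suc K) * Q         ∎
        where
        open ≡-Reasoning
        a σ : ℕ
        a = 3 + c + u
        σ = 3 + c + K * Q
        a<X : a < X
        a<X = low< (shifted< 3≤4)
        bounds : All (_< Z) squareBlocks
        bounds = block< (digit< 1≤4) (<-≤-trans a<X X≤P) ∷ block< (digit< z≤n) (inner< a<X 1≤4)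
               ∷ block< (digit< 2≤4) (<-≤-trans a<X X≤P) ∷ block< (digit< z≤n) (high< (shifted< 3≤4)) ∷ []
        collect : ∀ c K p' → let σ = 3 + c + K * (4 + c) in
                  (1 + σ) + ((σ + 1) + ((2 + σ) + ((3 + c + p' * (4 + c)) + 0)))
                  ≡ (suc p' + 3 * suc K) * (4 + c)
        collect = solve-∀

      s-2w² : s q (2 * (w * w)) ≡ (suc p' + 3 * suc K) * Q
      s-2w² = begin
        s q (2 * (w * w))                      ≡⟨ cong (s q) w-double-squared ⟩
        s q (fromBlocks Z doubleSquareBlocks)  ≡⟨ s-blocks Z-base bounds ⟩
        sum (map (s q) doubleSquareBlocks)
          ≡⟨ cong₂ _+_ (s-nested 2≤4 b<X 1≤4) (cong₂ _+_ (s-nested z≤n b<X 3≤4)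
               (cong₂ _+_ (s-nested ≤-refl b<X 1≤4) (cong (_+ (1 + 0)) (s-block (1 + c + y) z≤n)))) ⟩
        (2 + (s q b + 1)) + ((s q b + 3) + ((4 + (s q b + 1)) + (s q (1 + c + y) + (1 + 0))))
          ≡⟨ cong₂ (λ α β → (2 + (α + 1)) + ((α + 3) + ((4 + (α + 1)) + (β + (1 + 0)))))
                   (s-low (shifted< 1≤4)) (s-high (shifted< 1≤4)) ⟩
        (2 + (τ + 1)) + ((τ + 3) + ((4 + (τ + 1)) + ((1 + c + p' * Q) + (1 + 0))))
          ≡⟨ collect c K p' ⟩
        (suc p' + 3 * suc K) * Q               ∎
        where
        open ≡-Reasoning
        b τ : ℕ
        b = 1 + c + u
        τ = 1 + c + K * Q
        b<X : b < X
        b<X = low< (shifted< 1≤4)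
        bounds : All (_< Z) doubleSquareBlocks
        bounds = block< (digit< 2≤4) (inner< b<X 1≤4) ∷ block< (digit< z≤n) (inner< b<X 3≤4)
               ∷ block< (digit< ≤-refl) (inner< b<X 1≤4) ∷ block< (digit< z≤n) (high< (shifted< 1≤4))
               ∷ <-≤-trans (digit< 1≤4) (m≤m*n X P) ∷ []
        collect : ∀ c K p' → let τ = 1 + c + K * (4 + c) in
                  (2 + (τ + 1)) + ((τ + 3) + ((4 + (τ + 1)) + ((1 + c + p' * (4 + c)) + (1 + 0))))
                  ≡ (suc p' + 3 * suc K) * (4 + c)
        collect = solve-∀

    -- The gadget, packaged: only its three digit sums matter from here on.
    opaque
      gadget : ∀ {K p'} → K < p' → ∃ λ w →
               s q w ≡ (2 * suc p' + suc K) * Q ×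
               s q (w * w) ≡ (suc p' + 3 * suc K) * Q × s q (2 * (w * w)) ≡ (suc p' + 3 * suc K) * Q
      gadget {K} {p'} K<p' = w , s-w , s-w² , s-2w²
        where open Gadget K p' K<p'

  four-times : ∀ a → 4 * a ≡ 2 * a + 2 * a
  four-times = solve-∀

  choose-multiplier : ∀ {a b} .{{_ : NonZero b}} → b < 2 * a →
                      ∃ λ n → NonZero n × 2 * a < suc n * b × suc n * b < 4 * a
  choose-multiplier {a} {b} b<2a = n , >-nonZero (m≥n⇒m/n>0 (<⇒≤ b<2a)) , lower , upper
    where
    open ≤-Reasoning
    n : ℕ
    n = 2 * a / b
    lower : 2 * a < suc n * b
    lower = begin-strict
      2 * a              ≡⟨ m≡m%n+[m/n]*n (2 * a) b ⟩
      2 * a % b + n * b  <⟨ +-monoˡ-< (n * b) (m%n<n (2 * a) b) ⟩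
      b + n * b          ∎
    upper : suc n * b < 4 * a
    upper = begin-strict
      b + n * b      ≤⟨ +-monoʳ-≤ b (m/n*n≤m (2 * a) b) ⟩
      b + 2 * a      <⟨ +-monoˡ-< (2 * a) b<2a ⟩
      2 * a + 2 * a  ≡⟨ four-times a ⟨
      4 * a          ∎

  -- For 2a < N < 4a there are exponents K < p' with 2(p'+1) + (K+1) = 5N and
  -- (p'+1) + 3(K+1) = 10a, namely K + 1 = 4a - N and p' + 1 = 3N - 2a.
  choose-exponents : ∀ {a N} → 2 * a < N → N < 4 * a →
                     ∃ λ K → ∃ λ p' → K < p' × 2 * suc p' + suc K ≡ 5 * N × suc p' + 3 * suc K ≡ 10 * a
  choose-exponents {a} 2a<N N<4a with m≤n⇒∃[o]m+o≡n 2a<N | m≤n⇒∃[o]m+o≡n N<4a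
  ... | d , refl | K , N+K≡4a = K , p' , K<p' , five-N , ten-a
    where
    open ≡-Reasoning
    p' : ℕ
    p' = 4 * a + 2 + 3 * d
    -- Writing N = 2a + 1 + d, the hypothesis 4a = N + 1 + K says 2 + d + K = 2a.
    half : 2 + d + K ≡ 2 * a
    half = +-cancelˡ-≡ (2 * a) _ _ (begin
      2 * a + (2 + d + K)            ≡⟨ shape a d K ⟩
      suc (suc (2 * a) + d) + K      ≡⟨ N+K≡4a ⟩
      4 * a                          ≡⟨ four-times a ⟩
      2 * a + 2 * a                  ∎)
      where
      shape : ∀ a d K → 2 * a + (2 + d + K) ≡ suc (suc (2 * a) + d) + K
      shape = solve-∀
    K<p' : K < p'
    K<p' = ≤-trans (m≤n+m (suc K) (suc (2 * a) + d))
                   (≤-trans (≤-reflexive (trans (+-suc _ K) N+K≡4a)) (≤-trans (m≤m+n (4 * a) 2) (m≤m+n _ _)))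
    five-N : 2 * suc p' + suc K ≡ 5 * suc (2 * a + d)
    five-N = begin
      2 * suc p' + suc K             ≡⟨ split₁ a d K ⟩
      8 * a + 5 + 5 * d + (2 + d + K) ≡⟨ cong (8 * a + 5 + 5 * d +_) half ⟩
      8 * a + 5 + 5 * d + 2 * a      ≡⟨ split₂ a d ⟩
      5 * suc (2 * a + d)            ∎
      where
      split₁ : ∀ a d K → 2 * suc (4 * a + 2 + 3 * d) + suc K ≡ 8 * a + 5 + 5 * d + (2 + d + K)
      split₁ = solve-∀
      split₂ : ∀ a d → 8 * a + 5 + 5 * d + 2 * a ≡ 5 * suc (2 * a + d)
      split₂ = solve-∀
    ten-a : suc p' + 3 * suc K ≡ 10 * a
    ten-a = begin
      suc p' + 3 * suc K             ≡⟨ split₁ a d K ⟩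
      4 * a + 3 * (2 + d + K)        ≡⟨ cong (λ h → 4 * a + 3 * h) half ⟩
      4 * a + 3 * (2 * a)            ≡⟨ split₂ a ⟩
      10 * a                         ∎
      where
      split₁ : ∀ a d K → suc (4 * a + 2 + 3 * d) + 3 * suc K ≡ 4 * a + 3 * (2 + d + K)
      split₁ = solve-∀
      split₂ : ∀ a → 4 * a + 3 * (2 * a) ≡ 10 * a
      split₂ = solve-∀

  -- Main construction: for b < 2a and q ≥ 5 there is v with s(v) = T·b and
  -- s(v²) = T·a for some T ≠ 0.  Take n = ⌊2a/b⌋ and N = (n+1)b, build the
  -- gadget w for the exponents of choose-exponents (so s(w) = 5N·Q and
  -- s(w²) = s(2w²) = 10a·Q) and amplify it n times; then T = 5n(n+1)·Q.
  -- Kept opaque for the same reason as the gadget.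
  opaque
    realise : ∀ c a b .{{_ : NonZero b}} → b < 2 * a →
              ∃ λ v → ∃ λ T → NonZero T × s (5 + c) v ≡ T * b × s (5 + c) (v * v) ≡ T * a
    realise c a b b<2a with choose-multiplier {a} b<2a
    ... | n , n≢0 , lower , upper with choose-exponents {a} lower upper
    ... | K , p' , K<p' , five-N , ten-a with AtLeastFive.gadget c K<p'
    ... | w , s-w , s-w² , s-2w² with amplify (5 + c) (AtLeastFive.1<q c) w n s-w² s-2w²
    ... | v , s-v , s-v² = v , T , m*n≢0 n (5 * suc n * Q) {{n≢0}} , sv≡Tb , sv²≡Ta
      where
      open ≡-Reasoning
      q Q T : ℕ
      q = 5 + c
      Q = 4 + c
      T = n * (5 * suc n * Q)
      sv≡Tb : s q v ≡ T * b
      sv≡Tb = begin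
        s q v                           ≡⟨ s-v ⟩
        n * s q w                       ≡⟨ cong (n *_) s-w ⟩
        n * ((2 * suc p' + suc K) * Q)  ≡⟨ cong (λ x → n * (x * Q)) five-N ⟩
        n * (5 * (suc n * b) * Q)       ≡⟨ rearrange n b Q ⟩
        T * b                           ∎
        where
        rearrange : ∀ n b Q → n * (5 * (suc n * b) * Q) ≡ n * (5 * suc n * Q) * b
        rearrange = solve-∀
      sv²≡Ta : s q (v * v) ≡ T * a
      sv²≡Ta = begin
        s q (v * v)                                 ≡⟨ s-v² ⟩
        Tr (suc n) * ((suc p' + 3 * suc K) * Q)     ≡⟨ cong (λ x → Tr (suc n) * (x * Q)) ten-a ⟩
        Tr (suc n) * (10 * a * Q)                   ≡⟨ double (Tr (suc n)) a Q ⟩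
        2 * Tr (suc n) * (5 * a * Q)                ≡⟨ cong (_* (5 * a * Q)) (triangular n) ⟩
        n * suc n * (5 * a * Q)                     ≡⟨ rearrange n a Q ⟩
        T * a                                       ∎
        where
        double : ∀ m a Q → m * (10 * a * Q) ≡ 2 * m * (5 * a * Q)
        double = solve-∀
        rearrange : ∀ n a Q → n * suc n * (5 * a * Q) ≡ n * (5 * suc n * Q) * a
        rearrange = solve-∀

open import Defs
open import Data.Nat using (ℕ; _≤_; _*_; NonZero)
open import Data.Integer using (+_)
open import Data.Rational using (ℚ; ½; _<_; _/_)
open import Data.Product using (Σ; ∃; _,_)
open import Relation.Binary.PropositionalEquality using (_≡_)

open import Data.Nat using (suc; _+_)
import Data.Nat as ℕ
open import Data.Nat.Properties using (m*n≢0; *-comm; *-assoc; *-identityˡ; m≤n⇒∃[o]m+o≡n)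
open import Data.Integer using (-[1+_])
import Data.Integer as ℤ
open import Data.Integer.Properties using (pos-*; drop‿+<+)
open import Data.Rational using (mkℚ; *<*)
open import Data.Rational.Properties using (fromℚᵘ-cong; ↥p/↧p≡p)
open import Data.Rational.Unnormalised using (mkℚᵘ; *≡*)
open import Relation.Binary.PropositionalEquality using (refl; sym; cong; subst; subst₂; module ≡-Reasoning)
open Construction using (realise)

/-cross : ∀ x y m n .{{_ : NonZero m}} .{{_ : NonZero n}} → x * n ≡ y * m → (+ x) / m ≡ (+ y) / n
/-cross x y (suc m) (suc n) xn≡ym = fromℚᵘ-cong {mkℚᵘ (+ x) m} {mkℚᵘ (+ y) n} (*≡* (begin
  + x ℤ.* + suc n   ≡⟨ pos-* x (suc n) ⟨
  + (x * suc n)     ≡⟨ cong +_ xn≡ym ⟩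
  + (y * suc m)     ≡⟨ pos-* y (suc m) ⟩
  + y ℤ.* + suc m   ∎))
  where open ≡-Reasoning

half<⇒ : ∀ {a d} → + 1 ℤ.* + suc d ℤ.< + a ℤ.* + 2 → suc d ℕ.< 2 * a
half<⇒ {a} {d} 1+d<2a = subst₂ ℕ._<_ (*-identityˡ (suc d)) (*-comm a 2)
  (drop‿+<+ (subst₂ ℤ._<_ (sym (pos-* 1 (suc d))) (sym (pos-* a 2)) 1+d<2a))

ratio-realised : ∀ c (r : ℚ) → ½ < r →
    ∃ λ (v : ℕ) → Σ (NonZero (s (5 + c) v)) λ nz →
      ((+ s (5 + c) (v * v)) / s (5 + c) v) {{nz}} ≡ r
ratio-realised c r@(mkℚ (+ a) d _) (*<* ½<r) with realise c a (suc d) (half<⇒ {a} ½<r)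
... | v , T , T≢0 , s-v , s-v² = v , nz , (begin
  ((+ s q (v * v)) / s q v) {{nz}}  ≡⟨ /-cross (s q (v * v)) a (s q v) (suc d) {{nz}} cross ⟩
  (+ a) / suc d                     ≡⟨ ↥p/↧p≡p r ⟩
  r                                 ∎)
  where
  open ≡-Reasoning
  q : ℕ
  q = 5 + c
  nz : NonZero (s q v)
  nz = subst NonZero (sym s-v) (m*n≢0 T (suc d) {{T≢0}})
  cross : s q (v * v) * suc d ≡ a * s q v
  cross = begin
    s q (v * v) * suc d  ≡⟨ cong (_* suc d) s-v² ⟩
    T * a * suc d        ≡⟨ cong (_* suc d) (*-comm T a) ⟩
    a * T * suc d        ≡⟨ *-assoc a T (suc d) ⟩
    a * (T * suc d)      ≡⟨ cong (a *_) s-v ⟨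
    a * s q v            ∎
ratio-realised c (mkℚ -[1+ _ ] _ _) (*<* ())

lemma3p7 : (q : ℕ) → .{{nzq : NonZero q}} → 5 ≤ q → (r : ℚ) → ½ < r →
    ∃ λ (v : ℕ) → Σ (NonZero (s q v)) λ nz →
      ((+ s q (v * v)) / s q v) {{nz}} ≡ r
lemma3p7 q 5≤q r ½<r with m≤n⇒∃[o]m+o≡n 5≤q
... | c , refl = ratio-realised c r ½<r
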